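{- Let $K$ be a real quadratic field with discriminant $D$ and let $\alpha$ be a generator of $K$ (i.e. $K = \mathbf{Q}(\alpha)$) with $H(\alpha) \leq 0.48\sqrt{D}$. Then one of the elements $\alpha, \alpha', -\alpha, -\alpha'$ is reduced, where $\alpha'$ denotes the conjugate of $\alpha$.
   Context: For an algebraic number $\alpha$ with minimal polynomial $f = a_n x^n + \dots + a_0$ over $\mathbf{Q}$ normalized so that $a_i \in \mathbf{Z}$ and $\gcd(a_0,\dots,a_n)=1$, the height is $H(\alpha) = \max(|a_0|,\dots,|a_n|)$. An element $\beta$ of the real quadratic field of discriminant $D$ is called reduced if $\beta = \frac{b + \sqrt{D}}{2a}$ with $a, b, c \in \mathbf{Z}$, $b^2 - 4ac = D$ (where $\sqrt{D} > 0$), and $\beta > 1$, $-1 < \beta' < 0$, where $\beta'$ is the Galois conjugate of $\beta$. -}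

module Defs where

open import Data.Nat as ℕ using (ℕ; _%_)
open import Data.Nat.Divisibility using (_∣_)
open import Data.Nat.GCD using (gcd)
open import Data.Integer as ℤ using (ℤ; ∣_∣)
open import Data.Rational as ℚ using (ℚ; 0ℚ; 1ℚ; _/_)
open import Data.Product using (_×_; ∃; ∃-syntax; _,_)
open import Data.Sum using (_⊎_)
open import Relation.Binary.PropositionalEquality using (_≡_; _≢_)
open import Relation.Nullary using (¬_)

SquareFree : ℕ → Set
SquareFree n = ∀ k → k ℕ.* k ∣ n → k ≡ 1

-- D is the discriminant of a real quadratic field (fundamental discriminant D > 1).
IsRealQuadDisc : ℕ → Set
IsRealQuadDisc D =
  1 ℕ.< D ×
  ((D % 4 ≡ 1 × SquareFree D) ⊎
   (∃[ m ] (D ≡ 4 ℕ.* m × (m % 4 ≡ 2 ⊎ m % 4 ≡ 3) × SquareFree m)))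

-- Elements of K = Q(√D): the pair (p , q) stands for p + q√D, with √D > 0.
record K : Set where
  constructor _+√D·_
  field
    re : ℚ
    im : ℚ
open K public

module Field (D : ℕ) where

  Dℚ : ℚ
  Dℚ = ℤ.+ D / 1

  embed : ℚ → K
  embed r = r +√D· 0ℚ

  embedℤ : ℤ → K
  embedℤ i = embed (i / 1)

  √D : K
  √D = 0ℚ +√D· 1ℚ

  _⊕_ : K → K → K
  (p +√D· q) ⊕ (r +√D· s) = (p ℚ.+ r) +√D· (q ℚ.+ s)

  _⊗_ : K → K → K
  (p +√D· q) ⊗ (r +√D· s) =
    (p ℚ.* r ℚ.+ q ℚ.* s ℚ.* Dℚ) +√D· (p ℚ.* s ℚ.+ q ℚ.* r)

  ⊖_ : K → K
  ⊖ (p +√D· q) = (ℚ.- p) +√D· (ℚ.- q)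

  conj : K → K
  conj (p +√D· q) = p +√D· (ℚ.- q)

  -- Positivity of the real number x + y√D (√D > 0, D not a square).
  Pos : K → Set
  Pos (x +√D· y) =
    (0ℚ ℚ.≤ x × 0ℚ ℚ.≤ y × (0ℚ ℚ.< x ⊎ 0ℚ ℚ.< y)) ⊎
    (0ℚ ℚ.< x × y ℚ.< 0ℚ × y ℚ.* y ℚ.* Dℚ ℚ.< x ℚ.* x) ⊎
    (x ℚ.< 0ℚ × 0ℚ ℚ.< y × x ℚ.* x ℚ.< y ℚ.* y ℚ.* Dℚ)

  _<ᴷ_ : K → K → Set
  u <ᴷ v = Pos (v ⊕ (⊖ u))

  _≤ᴷ_ : K → K → Set
  u ≤ᴷ v = u ≡ v ⊎ u <ᴷ v

  Generates : K → Set
  Generates α = ∀ z → ∃[ r ] ∃[ s ] (z ≡ embed r ⊕ (embed s ⊗ α))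

  evalPoly : ℤ → ℤ → ℤ → K → K
  evalPoly a b c x = (embedℤ a ⊗ (x ⊗ x)) ⊕ ((embedℤ b ⊗ x) ⊕ embedℤ c)

  -- a x² + b x + c is the normalized (integer, primitive) minimal polynomial of
  -- α over Q, in the quadratic case: degree 2, coefficients coprime, irreducible
  -- over Q (no rational root), and vanishing at α.
  IsMinPoly2 : K → ℤ → ℤ → ℤ → Set
  IsMinPoly2 α a b c =
    a ≢ ℤ.0ℤ ×
    gcd (gcd ∣ a ∣ ∣ b ∣) ∣ c ∣ ≡ 1 ×
    (∀ r → ¬ (evalPoly a b c (embed r) ≡ embed 0ℚ)) ×
    evalPoly a b c α ≡ embed 0ℚ

  -- H(α) = h : height of α (max abs value of coefficients of its normalized
  -- minimal polynomial), for α of degree 2.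
  Height : K → ℕ → Set
  Height α h = ∃[ a ] ∃[ b ] ∃[ c ]
    (IsMinPoly2 α a b c × h ≡ (∣ a ∣ ℕ.⊔ ∣ b ∣) ℕ.⊔ ∣ c ∣)

  Reduced : K → Set
  Reduced β =
    (∃[ a ] ∃[ b ] ∃[ c ]
      (a ≢ ℤ.0ℤ ×
       b ℤ.* b ℤ.- ℤ.+ 4 ℤ.* a ℤ.* c ≡ ℤ.+ D ×
       embedℤ (ℤ.+ 2 ℤ.* a) ⊗ β ≡ embedℤ b ⊕ √D)) ×
    embed 1ℚ <ᴷ β ×
    embed (ℚ.- 1ℚ) <ᴷ conj β ×
    conj β <ᴷ embed 0ℚ

{-# OPTIONS --safe #-}
module Submission where

-- Write α = p + q√D with minimal polynomial ax² + bx + c.  Comparing rational and irrational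
-- parts of aα² + bα + c = 0 gives 2ap = -b and (2aq)²D = b² - 4ac =: Δ.  The height bound
-- h < 0.48√D gives |Δ| ≤ 5h² < 1.2 D.  Writing 2aq = u/v in lowest terms, v² divides D, so
-- v = 1, or v = 2 and D = 4m with m ≡ 2, 3 (mod 4); the bound forces u = 1, and v = 2 would
-- make Δ = m, impossible since Δ ≡ b² (mod 4).  Hence 2aq = ±1 and Δ = D, i.e.
-- α = (-b ± √D)/(2a).  Replacing α by ±α or ±α' (and (a, b, c) by -(a, b, c)) we reach
-- β = (B + √D)/(2A) with A > 0, B ≥ 0 and D = B² + 4AC.  Such β is reduced as soon as
-- |2A - B| < √D, B < √D and √D < B + 2A.  The first two follow from A, B ≤ h and 4h² < D; for
-- the last, C ≥ A + B would give 144 D ≤ 625 (AC + B²) ≤ 625 C² ≤ 625 h² < 144 D.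

open import Defs
open import Data.Nat using (ℕ)
open import Data.Integer using (+_)
open import Data.Rational using (0ℚ; _/_)
open import Data.Sum using (_⊎_)

open import Data.Empty using (⊥-elim)
open import Data.Integer as ℤ using (ℤ; -[1+_]; +[1+_]; ∣_∣)
import Data.Integer.Properties as ℤP
open import Data.Integer.Tactic.RingSolver using (solve-∀)
open import Data.List using (_∷_; [])
open import Data.Nat as ℕ using (zero; suc; _%_; NonZero; z≤n; s≤s)
open import Data.Nat.Coprimality as Coprimality using (Coprime)
open import Data.Nat.Divisibility as ℕDiv using (_∣_; divides; _∣?_)
import Data.Nat.DivMod as ℕDivMod
import Data.Nat.Properties as ℕP
import Data.Nat.Tactic.RingSolver as ℕ-Ring
open import Data.Product using (_×_; _,_; proj₁; proj₂; ∃-syntax)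
import Data.Product as Product
open import Data.Rational as ℚ using (ℚ; mkℚ; 1ℚ; Positive)
import Data.Rational.Properties as ℚP
open import Algebra.Properties.Group ℚP.+-0-group using () renaming (⁻¹-involutive to neg-involutive)
open import Data.Rational.Solver using (module +-*-Solver)
import Data.Rational.Unnormalised as ℚᵘ
import Data.Rational.Unnormalised.Properties as ℚᵘP
open import Data.Sum using (inj₁; inj₂)
import Data.Sum as Sum
open import Function using (_∘_)
open import Relation.Binary.PropositionalEquality
open import Relation.Nullary using (¬_; yes; no; contradiction)

-- Defs embeds integers as i / 1, which does not compute for a variable i; fromℤ builds the
-- normal form directly, so that ↥ (fromℤ i) = i and signs of products reduce.
fromℤ : ℤ → ℚ
fromℤ i = mkℚ i 0 (Coprimality.sym (Coprimality.1-coprimeTo ∣ i ∣))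

fromℕ : ℕ → ℚ
fromℕ n = fromℤ (+ n)

/1≡fromℤ : ∀ i → i / 1 ≡ fromℤ i
/1≡fromℤ (+ n)    = ℚP.normalize-coprime (Coprimality.sym (Coprimality.1-coprimeTo n))
/1≡fromℤ -[1+ n ] = cong ℚ.-_ (/1≡fromℤ (+ suc n))

fromℤ-homo-* : ∀ i j → fromℤ (i ℤ.* j) ≡ fromℤ i ℚ.* fromℤ j
fromℤ-homo-* i j = sym (/1≡fromℤ (i ℤ.* j))

fromℤ-homo-+ : ∀ i j → fromℤ (i ℤ.+ j) ≡ fromℤ i ℚ.+ fromℤ j
fromℤ-homo-+ i j =
  sym (trans (/1≡fromℤ _) (cong fromℤ (cong₂ ℤ._+_ (ℤP.*-identityʳ i) (ℤP.*-identityʳ j))))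

fromℤ-homo-neg : ∀ i → fromℤ (ℤ.- i) ≡ ℚ.- fromℤ i
fromℤ-homo-neg (+ zero) = refl
fromℤ-homo-neg +[1+ n ] = refl
fromℤ-homo-neg -[1+ n ] = refl

fromℕ-homo-+ : ∀ m n → fromℕ (m ℕ.+ n) ≡ fromℕ m ℚ.+ fromℕ n
fromℕ-homo-+ m n = trans (cong fromℤ (ℤP.pos-+ m n)) (fromℤ-homo-+ (+ m) (+ n))

fromℕ-square : ∀ n → fromℕ (n ℕ.* n) ≡ fromℕ n ℚ.* fromℕ n
fromℕ-square n = trans (cong fromℤ (ℤP.pos-* n n)) (fromℤ-homo-* (+ n) (+ n))

fromℕ-sub : ∀ m n → fromℕ m ℚ.- fromℕ n ≡ fromℤ (m ℤ.⊖ n)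
fromℕ-sub m n = begin
  fromℕ m ℚ.- fromℕ n          ≡⟨ cong (fromℕ m ℚ.+_) (fromℤ-homo-neg (+ n)) ⟨
  fromℕ m ℚ.+ fromℤ (ℤ.- + n)  ≡⟨ fromℤ-homo-+ (+ m) (ℤ.- + n) ⟨
  fromℤ (+ m ℤ.- + n)          ≡⟨ cong fromℤ (ℤP.m-n≡m⊖n m n) ⟩
  fromℤ (m ℤ.⊖ n)              ∎
  where open ≡-Reasoning

fromℤ-discriminant : ∀ a b c →
  fromℤ (b ℤ.* b ℤ.- + 4 ℤ.* a ℤ.* c) ≡ fromℤ b ℚ.* fromℤ b ℚ.- fromℕ 4 ℚ.* fromℤ a ℚ.* fromℤ c
fromℤ-discriminant a b c = begin
  fromℤ (b ℤ.* b ℤ.- + 4 ℤ.* a ℤ.* c)                ≡⟨ fromℤ-homo-+ (b ℤ.* b) (ℤ.- (+ 4 ℤ.* a ℤ.* c)) ⟩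
  fromℤ (b ℤ.* b) ℚ.+ fromℤ (ℤ.- (+ 4 ℤ.* a ℤ.* c))  ≡⟨ cong₂ ℚ._+_ (fromℤ-homo-* b b) (fromℤ-homo-neg _) ⟩
  fromℤ b ℚ.* fromℤ b ℚ.- fromℤ (+ 4 ℤ.* a ℤ.* c)    ≡⟨ cong (ℚ._-_ (fromℤ b ℚ.* fromℤ b)) 4ac ⟩
  fromℤ b ℚ.* fromℤ b ℚ.- fromℕ 4 ℚ.* fromℤ a ℚ.* fromℤ c ∎
  where
  open ≡-Reasoning
  4ac : fromℤ (+ 4 ℤ.* a ℤ.* c) ≡ fromℕ 4 ℚ.* fromℤ a ℚ.* fromℤ c
  4ac = trans (fromℤ-homo-* (+ 4 ℤ.* a) c) (cong (ℚ._* fromℤ c) (fromℤ-homo-* (+ 4) a))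

fromℤ-mono-< : ∀ {i j} → i ℤ.< j → fromℤ i ℚ.< fromℤ j
fromℤ-mono-< {i} {j} = ℚ.*<* ∘ subst₂ ℤ._<_ (sym (ℤP.*-identityʳ i)) (sym (ℤP.*-identityʳ j))

fromℤ-cancel-< : ∀ {i j} → fromℤ i ℚ.< fromℤ j → i ℤ.< j
fromℤ-cancel-< {i} {j} (ℚ.*<* i<j) = subst₂ ℤ._<_ (ℤP.*-identityʳ i) (ℤP.*-identityʳ j) i<j

fromℤ-cancel-≤ : ∀ {i j} → fromℤ i ℚ.≤ fromℤ j → i ℤ.≤ j
fromℤ-cancel-≤ {i} {j} (ℚ.*≤* i≤j) = subst₂ ℤ._≤_ (ℤP.*-identityʳ i) (ℤP.*-identityʳ j) i≤j

fromℤ-2*-≢0 : ∀ {a} → a ≢ + 0 → fromℤ (+ 2 ℤ.* a) ≢ 0ℚ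
fromℤ-2*-≢0 {a} a≢0 2a≡0 with ℤP.i*j≡0⇒i≡0∨j≡0 (+ 2) (cong ℚ.↥_ 2a≡0)
... | inj₂ a≡0 = a≢0 a≡0

x*y≡0⇒y≡0 : ∀ {x y} → x ≢ 0ℚ → x ℚ.* y ≡ 0ℚ → y ≡ 0ℚ
x*y≡0⇒y≡0 {x} {y} x≢0 xy≡0 = begin
  y                     ≡⟨ ℚP.*-identityˡ y ⟨
  1ℚ ℚ.* y              ≡⟨ cong (ℚ._* y) (ℚP.*-inverseˡ x) ⟨
  ℚ.1/ x ℚ.* x ℚ.* y    ≡⟨ ℚP.*-assoc (ℚ.1/ x) x y ⟩
  ℚ.1/ x ℚ.* (x ℚ.* y)  ≡⟨ cong (ℚ.1/ x ℚ.*_) xy≡0 ⟩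
  ℚ.1/ x ℚ.* 0ℚ         ≡⟨ ℚP.*-zeroʳ (ℚ.1/ x) ⟩
  0ℚ                    ∎
  where
  open ≡-Reasoning
  instance _ = ℚ.≢-nonZero x≢0

scaled-neg : ∀ t x u → t ℚ.* x ≡ ℚ.- u → t ℚ.* ℚ.- x ≡ u
scaled-neg t x u tx≡-u = trans (sym (ℚP.neg-distribʳ-* t x)) (trans (cong ℚ.-_ tx≡-u) (neg-involutive u))

neg-scaled : ∀ t x u → ℚ.- t ℚ.* x ≡ ℚ.- u → t ℚ.* x ≡ u
neg-scaled t x u -tx≡-u =
  trans (sym (neg-involutive (t ℚ.* x))) (trans (cong ℚ.-_ (ℚP.neg-distribˡ-* t x)) (trans (cong ℚ.-_ -tx≡-u) (neg-involutive u)))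

±1-square : ∀ {r} x → r ≡ 1ℚ ⊎ r ≡ ℚ.- 1ℚ → r ℚ.* r ℚ.* x ≡ x
±1-square x (inj₁ refl) = ℚP.*-identityˡ x
±1-square x (inj₂ refl) = ℚP.*-identityˡ x

module Scaling (t : ℚ) .{{_ : Positive t}} where
  open +-*-Solver

  scaled-< : ∀ {x z x′ z′} → t ℚ.* x ≡ x′ → t ℚ.* z ≡ z′ → x′ ℚ.< z′ → x ℚ.< z
  scaled-< refl refl = ℚP.*-cancelˡ-<-nonNeg t {{ℚP.pos⇒nonNeg t}}

  scaled-≤ : ∀ {x z x′ z′} → t ℚ.* x ≡ x′ → t ℚ.* z ≡ z′ → x′ ℚ.≤ z′ → x ℚ.≤ z
  scaled-≤ refl refl = ℚP.*-cancelˡ-≤-pos t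

  scaled-square : ∀ {x x′} → t ℚ.* x ≡ x′ → (t ℚ.* t) ℚ.* (x ℚ.* x) ≡ x′ ℚ.* x′
  scaled-square {x} refl = solve 2 (λ t x → (t :* t) :* (x :* x) := (t :* x) :* (t :* x)) refl t x

  scaled-square-* : ∀ {x x′} → t ℚ.* x ≡ x′ → ∀ z → (t ℚ.* t) ℚ.* (x ℚ.* x ℚ.* z) ≡ x′ ℚ.* x′ ℚ.* z
  scaled-square-* {x} tx≡x′ z = trans (sym (ℚP.*-assoc (t ℚ.* t) (x ℚ.* x) z)) (cong (ℚ._* z) (scaled-square tx≡x′))

-- Discriminants

square-abs : ∀ i → i ℤ.* i ≡ + (∣ i ∣ ℕ.* ∣ i ∣)
square-abs (+ n)    = sym (ℤP.pos-* n n)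
square-abs -[1+ n ] = refl

pos-4AC : ∀ A C → + (4 ℕ.* A ℕ.* C) ≡ + 4 ℤ.* + A ℤ.* + C
pos-4AC A C = trans (ℤP.pos-* (4 ℕ.* A) C) (cong (ℤ._* + C) (ℤP.pos-* 4 A))

pos-discriminant : ∀ A B C → + B ℤ.* + B ℤ.- + 4 ℤ.* + A ℤ.* ℤ.- + C ≡ + (B ℕ.* B ℕ.+ 4 ℕ.* A ℕ.* C)
pos-discriminant A B C = trans (negate-c (+ A) (+ B) (+ C)) (sym cast)
  where
  negate-c : ∀ a b c → b ℤ.* b ℤ.- + 4 ℤ.* a ℤ.* ℤ.- c ≡ b ℤ.* b ℤ.+ + 4 ℤ.* a ℤ.* c
  negate-c = solve-∀
  cast : + (B ℕ.* B ℕ.+ 4 ℕ.* A ℕ.* C) ≡ + B ℤ.* + B ℤ.+ + 4 ℤ.* + A ℤ.* + C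
  cast = trans (ℤP.pos-+ (B ℕ.* B) (4 ℕ.* A ℕ.* C)) (cong₂ ℤ._+_ (ℤP.pos-* B B) (pos-4AC A C))

discriminant≡B²+4A∣c∣ : ∀ {D} A B c → + B ℤ.* + B ℤ.- + 4 ℤ.* + A ℤ.* c ≡ + D → B ℕ.* B ℕ.< D →
                   D ≡ B ℕ.* B ℕ.+ 4 ℕ.* A ℕ.* ∣ c ∣
discriminant≡B²+4A∣c∣ {D} A B (+ n) Δ≡D B²<D = ⊥-elim (ℕP.<⇒≱ B²<D (ℤP.drop‿+≤+ (begin
  + D                                  ≡⟨ Δ≡D ⟨
  + B ℤ.* + B ℤ.- + 4 ℤ.* + A ℤ.* + n  ≡⟨ cong (λ j → + B ℤ.* + B ℤ.- j) (pos-4AC A n) ⟨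
  + B ℤ.* + B ℤ.- + (4 ℕ.* A ℕ.* n)    ≤⟨ ℤP.i-j≤i (+ B ℤ.* + B) (+ (4 ℕ.* A ℕ.* n)) ⟩
  + B ℤ.* + B                          ≡⟨ ℤP.pos-* B B ⟨
  + (B ℕ.* B)                          ∎)))
  where open ℤP.≤-Reasoning
discriminant≡B²+4A∣c∣ A B -[1+ n ] Δ≡D _ = ℤP.+-injective (trans (sym Δ≡D) (pos-discriminant A B (suc n)))

∣discriminant∣-bound : ∀ {h} a b c → ∣ a ∣ ℕ.≤ h → ∣ b ∣ ℕ.≤ h → ∣ c ∣ ℕ.≤ h →
                       ∣ b ℤ.* b ℤ.- + 4 ℤ.* a ℤ.* c ∣ ℕ.≤ h ℕ.* h ℕ.* 5
∣discriminant∣-bound {h} a b c a≤h b≤h c≤h = begin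
  ∣ b ℤ.* b ℤ.- + 4 ℤ.* a ℤ.* c ∣           ≤⟨ ℤP.∣i+j∣≤∣i∣+∣j∣ (b ℤ.* b) (ℤ.- (+ 4 ℤ.* a ℤ.* c)) ⟩
  ∣ b ℤ.* b ∣ ℕ.+ ∣ ℤ.- (+ 4 ℤ.* a ℤ.* c) ∣  ≡⟨ cong₂ ℕ._+_ (ℤP.abs-* b b) ∣4ac∣ ⟩
  ∣ b ∣ ℕ.* ∣ b ∣ ℕ.+ 4 ℕ.* ∣ a ∣ ℕ.* ∣ c ∣  ≤⟨ ℕP.+-mono-≤ (ℕP.*-mono-≤ b≤h b≤h) (ℕP.*-mono-≤ (ℕP.*-monoʳ-≤ 4 a≤h) c≤h) ⟩
  h ℕ.* h ℕ.+ 4 ℕ.* h ℕ.* h                  ≡⟨ ℕ-Ring.solve (h ∷ []) ⟩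
  h ℕ.* h ℕ.* 5                              ∎
  where
  open ℕP.≤-Reasoning
  ∣4ac∣ : ∣ ℤ.- (+ 4 ℤ.* a ℤ.* c) ∣ ≡ 4 ℕ.* ∣ a ∣ ℕ.* ∣ c ∣
  ∣4ac∣ = trans (ℤP.∣-i∣≡∣i∣ (+ 4 ℤ.* a ℤ.* c))
                (trans (ℤP.abs-* (+ 4 ℤ.* a) c) (cong (ℕ._* ∣ c ∣) (ℤP.abs-* (+ 4) a)))

square-mod-4 : ∀ n → (n ℕ.* n) % 4 ≡ 0 ⊎ (n ℕ.* n) % 4 ≡ 1
square-mod-4 n = subst (λ r → r ≡ 0 ⊎ r ≡ 1) (sym (ℕDivMod.%-distribˡ-* n n 4)) (residue (n % 4) (ℕDivMod.m%n<n n 4))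
  where
  residue : ∀ r → r ℕ.< 4 → (r ℕ.* r) % 4 ≡ 0 ⊎ (r ℕ.* r) % 4 ≡ 1
  residue 0 _ = inj₁ refl
  residue 1 _ = inj₂ refl
  residue 2 _ = inj₁ refl
  residue 3 _ = inj₂ refl
  residue (suc (suc (suc (suc _)))) (s≤s (s≤s (s≤s (s≤s ()))))

%-cong-multiple : ∀ d .{{_ : NonZero d}} {m n} x → + m ℤ.+ + d ℤ.* x ≡ + n → m % d ≡ n % d
%-cong-multiple d {m} {n} (+ k) m+dk≡n = begin
  m % d                ≡⟨ ℕDivMod.[m+kn]%n≡m%n m k d ⟨
  (m ℕ.+ k ℕ.* d) % d  ≡⟨ cong (_% d) (ℤP.+-injective (trans cast m+dk≡n)) ⟩
  n % d                ∎
  where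
  open ≡-Reasoning
  cast : + (m ℕ.+ k ℕ.* d) ≡ + m ℤ.+ + d ℤ.* + k
  cast = trans (ℤP.pos-+ m (k ℕ.* d)) (cong (ℤ._+_ (+ m)) (trans (cong +_ (ℕP.*-comm k d)) (ℤP.pos-* d k)))
%-cong-multiple d {m} {n} -[1+ k ] m-dk≡n = begin
  m % d                    ≡⟨ cong (_% d) (ℤP.+-injective (trans m≡n+dk (sym cast))) ⟩
  (n ℕ.+ suc k ℕ.* d) % d  ≡⟨ ℕDivMod.[m+kn]%n≡m%n n (suc k) d ⟩
  n % d                    ∎
  where
  open ≡-Reasoning
  cast : + (n ℕ.+ suc k ℕ.* d) ≡ + n ℤ.+ + d ℤ.* + suc k
  cast = trans (ℤP.pos-+ n (suc k ℕ.* d)) (cong (ℤ._+_ (+ n)) (trans (cong +_ (ℕP.*-comm (suc k) d)) (ℤP.pos-* d (suc k))))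
  shift : ∀ m d x → m ≡ (m ℤ.+ d ℤ.* x) ℤ.+ d ℤ.* ℤ.- x
  shift = solve-∀
  m≡n+dk : + m ≡ + n ℤ.+ + d ℤ.* + suc k
  m≡n+dk = trans (shift (+ m) (+ d) -[1+ k ]) (cong (ℤ._+ + d ℤ.* + suc k) m-dk≡n)

discriminant-mod-4 : ∀ a b c {n} → b ℤ.* b ℤ.- + 4 ℤ.* a ℤ.* c ≡ + n → n % 4 ≡ 0 ⊎ n % 4 ≡ 1
discriminant-mod-4 a b c {n} Δ≡n = subst (λ r → r ≡ 0 ⊎ r ≡ 1) (sym n≡b²) (square-mod-4 ∣ b ∣)
  where
  shift : ∀ a b c → b ℤ.* b ≡ (b ℤ.* b ℤ.- + 4 ℤ.* a ℤ.* c) ℤ.+ + 4 ℤ.* (a ℤ.* c)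
  shift = solve-∀
  n≡b² : n % 4 ≡ (∣ b ∣ ℕ.* ∣ b ∣) % 4
  n≡b² = %-cong-multiple 4 (a ℤ.* c)
           (trans (cong (ℤ._+ + 4 ℤ.* (a ℤ.* c)) (sym Δ≡n)) (trans (sym (shift a b c)) (square-abs b)))

residue-clash : ∀ {r} → r ≡ 0 ⊎ r ≡ 1 → ¬ (r ≡ 2 ⊎ r ≡ 3)
residue-clash (inj₁ refl) (inj₁ ())
residue-clash (inj₁ refl) (inj₂ ())
residue-clash (inj₂ refl) (inj₁ ())
residue-clash (inj₂ refl) (inj₂ ())

¬2∣⇒coprime-2 : ∀ {n} → ¬ 2 ∣ n → Coprime n 2
¬2∣⇒coprime-2 2∤n {0} (_ , 0∣2) with ℕDiv.0∣⇒≡0 0∣2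
... | ()
¬2∣⇒coprime-2 2∤n {1} _ = refl
¬2∣⇒coprime-2 2∤n {2} (2∣n , _) = contradiction 2∣n 2∤n
¬2∣⇒coprime-2 2∤n {suc (suc (suc d))} (_ , d∣2) with ℕDiv.∣⇒≤ d∣2
... | s≤s (s≤s ())

coprime-square-∣ : ∀ {m n o} .{{_ : NonZero m}} → Coprime m n → m ℕ.* m ∣ n ℕ.* n ℕ.* o → m ℕ.* m ∣ o
coprime-square-∣ {m} {n} {o} m⊥n mm∣nno with m∣o
  where
  m∣o : m ∣ o
  m∣o = Coprimality.coprime-divisor m⊥n (Coprimality.coprime-divisor m⊥n
          (ℕDiv.∣-trans (ℕDiv.m∣m*n m) (subst (m ℕ.* m ∣_) (ℕP.*-assoc n n o) mm∣nno)))
... | divides k refl = ℕDiv.*-monoˡ-∣ m m∣k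
  where
  mm∣nnkm : m ℕ.* m ∣ n ℕ.* n ℕ.* k ℕ.* m
  mm∣nnkm = subst (m ℕ.* m ∣_) (sym (ℕP.*-assoc (n ℕ.* n) k m)) mm∣nno
  m∣k : m ∣ k
  m∣k = Coprimality.coprime-divisor m⊥n (Coprimality.coprime-divisor m⊥n
          (subst (m ∣_) (ℕP.*-assoc n n k) (ℕDiv.*-cancelʳ-∣ m mm∣nnkm)))

square∣disc : ∀ {D V} .{{_ : NonZero V}} → IsRealQuadDisc D → V ℕ.* V ∣ D →
              V ≡ 1 ⊎ (V ≡ 2 × ∃[ m ] (D ≡ 4 ℕ.* m × (m % 4 ≡ 2 ⊎ m % 4 ≡ 3)))
square∣disc (_ , inj₁ (_ , squareFree)) VV∣D = inj₁ (squareFree _ VV∣D)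
square∣disc {V = V} (_ , inj₂ (m , refl , m%4 , squareFree)) VV∣4m with 2 ∣? V
... | yes (divides W refl) = inj₂ (cong (ℕ._* 2) (squareFree W WW∣m) , m , refl , m%4)
  where
  [2W]²≡W²*4 : W ℕ.* 2 ℕ.* (W ℕ.* 2) ≡ W ℕ.* W ℕ.* 4
  [2W]²≡W²*4 = ℕ-Ring.solve (W ∷ [])
  WW∣m : W ℕ.* W ∣ m
  WW∣m = ℕDiv.*-cancelʳ-∣ 4 (subst₂ _∣_ [2W]²≡W²*4 (ℕP.*-comm 4 m) VV∣4m)
... | no 2∤V = inj₁ (squareFree V (coprime-square-∣ (¬2∣⇒coprime-2 2∤V) VV∣4m))

ratio-square-bound : ∀ {U V N D} .{{_ : NonZero V}} → U ℕ.* U ℕ.* D ≡ N ℕ.* (V ℕ.* V) →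
                     N ℕ.* 5 ℕ.< D ℕ.* 6 → U ℕ.* U ℕ.* 5 ℕ.< V ℕ.* V ℕ.* 6
ratio-square-bound {U} {V} {N} {D} UUD≡NVV 5N<6D = ℕP.*-cancelʳ-< D _ _ (begin-strict
  U ℕ.* U ℕ.* 5 ℕ.* D    ≡⟨ ℕ-Ring.solve (U ∷ D ∷ []) ⟩
  U ℕ.* U ℕ.* D ℕ.* 5    ≡⟨ cong (ℕ._* 5) UUD≡NVV ⟩
  N ℕ.* (V ℕ.* V) ℕ.* 5  ≡⟨ ℕ-Ring.solve (N ∷ V ∷ []) ⟩
  N ℕ.* 5 ℕ.* (V ℕ.* V)  <⟨ ℕP.*-monoˡ-< (V ℕ.* V) {{ℕP.m*n≢0 V V}} 5N<6D ⟩
  D ℕ.* 6 ℕ.* (V ℕ.* V)  ≡⟨ ℕ-Ring.solve (D ∷ V ∷ []) ⟩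
  V ℕ.* V ℕ.* 6 ℕ.* D    ∎)
  where open ℕP.≤-Reasoning

square-mono : ∀ {m n} → m ℕ.≤ n → m ℕ.* m ℕ.* 5 ℕ.≤ n ℕ.* n ℕ.* 5
square-mono m≤n = ℕP.*-monoˡ-≤ 5 (ℕP.*-mono-≤ m≤n m≤n)

numerator≡1 : ∀ U V → V ℕ.≤ 2 → Coprime U V → U ≢ 0 → U ℕ.* U ℕ.* 5 ℕ.< V ℕ.* V ℕ.* 6 → U ≡ 1
numerator≡1 0                   _ _ _   U≢0 _  = ⊥-elim (U≢0 refl)
numerator≡1 1                   _ _ _   _   _  = refl
numerator≡1 (suc (suc U))       0 _ _   _   ()
numerator≡1 (suc (suc U))       1 _ _   _   lt =
  ⊥-elim (ℕP.<⇒≱ lt (ℕP.≤-trans (ℕP.m≤m+n 6 14) (square-mono {2} {suc (suc U)} (s≤s (s≤s z≤n)))))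
numerator≡1 2                   2 _ 2⊥2 _   _  = contradiction (2⊥2 (ℕDiv.∣-refl , ℕDiv.∣-refl)) λ ()
numerator≡1 (suc (suc (suc U))) 2 _ _   _   lt =
  ⊥-elim (ℕP.<⇒≱ lt (ℕP.≤-trans (ℕP.m≤m+n 24 21) (square-mono {3} {suc (suc (suc U))} (s≤s (s≤s (s≤s z≤n))))))
numerator≡1 (suc (suc U)) (suc (suc (suc V))) (s≤s (s≤s ())) _ _ _

coprime-square-ratio≡1 : ∀ {D U V N} .{{_ : NonZero V}} → IsRealQuadDisc D → Coprime U V → U ≢ 0 →
  U ℕ.* U ℕ.* D ≡ N ℕ.* (V ℕ.* V) → N ℕ.* 5 ℕ.< D ℕ.* 6 → N % 4 ≡ 0 ⊎ N % 4 ≡ 1 → U ≡ 1 × V ≡ 1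
coprime-square-ratio≡1 {D} {U} {V} {N} isDisc U⊥V U≢0 UUD≡NVV 5N<6D N%4
  with square∣disc isDisc (coprime-square-∣ (Coprimality.sym U⊥V) (divides N UUD≡NVV))
... | inj₁ refl = numerator≡1 U 1 (s≤s z≤n) U⊥V U≢0 (ratio-square-bound {U} {1} {N} {D} UUD≡NVV 5N<6D) , refl
... | inj₂ (refl , m , refl , m%4) = ⊥-elim (residue-clash (subst (λ n → n % 4 ≡ 0 ⊎ n % 4 ≡ 1) N≡m N%4) m%4)
  where
  U≡1 : U ≡ 1
  U≡1 = numerator≡1 U 2 ℕP.≤-refl U⊥V U≢0 (ratio-square-bound {U} {2} {N} UUD≡NVV 5N<6D)
  N≡m : N ≡ m
  N≡m = ℕP.*-cancelʳ-≡ N m 4 (begin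
    N ℕ.* 4                ≡⟨ UUD≡NVV ⟨
    U ℕ.* U ℕ.* (4 ℕ.* m)  ≡⟨ cong (λ u → u ℕ.* u ℕ.* (4 ℕ.* m)) U≡1 ⟩
    1 ℕ.* 1 ℕ.* (4 ℕ.* m)  ≡⟨ ℕ-Ring.solve (m ∷ []) ⟩
    m ℕ.* 4                ∎)
    where open ≡-Reasoning

-- Rational numbers whose square times D is an integer

mkℚ-square : ∀ u v .(u⊥v : Coprime ∣ u ∣ (suc v)) D Δ → mkℚ u v u⊥v ℚ.* mkℚ u v u⊥v ℚ.* fromℕ D ≡ fromℤ Δ →
             + (∣ u ∣ ℕ.* ∣ u ∣ ℕ.* D) ≡ Δ ℤ.* + (suc v ℕ.* suc v)
mkℚ-square u v u⊥v D Δ r²D≡Δ = begin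
  + (∣ u ∣ ℕ.* ∣ u ∣ ℕ.* D)        ≡⟨ ℤP.pos-* (∣ u ∣ ℕ.* ∣ u ∣) D ⟩
  + (∣ u ∣ ℕ.* ∣ u ∣) ℤ.* + D      ≡⟨ cong (ℤ._* + D) (square-abs u) ⟨
  u ℤ.* u ℤ.* + D                  ≡⟨ ℤP.*-identityʳ _ ⟨
  u ℤ.* u ℤ.* + D ℤ.* + 1          ≡⟨ ℚᵘP.drop-*≡* unnormalised ⟩
  Δ ℤ.* + (suc v ℕ.* suc v ℕ.* 1)  ≡⟨ cong (λ n → Δ ℤ.* + n) (ℕP.*-identityʳ _) ⟩
  Δ ℤ.* + (suc v ℕ.* suc v)        ∎
  where
  open ≡-Reasoning
  r : ℚ
  r = mkℚ u v u⊥v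
  unnormalised : ℚᵘ.mkℚᵘ u v ℚᵘ.* ℚᵘ.mkℚᵘ u v ℚᵘ.* ℚᵘ.mkℚᵘ (+ D) 0 ℚᵘ.≃ ℚᵘ.mkℚᵘ Δ 0
  unnormalised = ℚᵘP.≃-trans
    (ℚᵘP.≃-sym (ℚᵘP.≃-trans (ℚP.toℚᵘ-homo-* (r ℚ.* r) (fromℕ D)) (ℚᵘP.*-congʳ (ℚP.toℚᵘ-homo-* r r))))
    (ℚP.toℚᵘ-cong r²D≡Δ)

nonNegative-factor : ∀ {m n} i → + m ≡ i ℤ.* + suc n → i ≡ + ∣ i ∣
nonNegative-factor (+ _)    _ = refl
nonNegative-factor -[1+ _ ] ()

mkℚ-±1 : ∀ u v .(u⊥v : Coprime ∣ u ∣ (suc v)) → ∣ u ∣ ≡ 1 → suc v ≡ 1 →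
         mkℚ u v u⊥v ≡ 1ℚ ⊎ mkℚ u v u⊥v ≡ ℚ.- 1ℚ
mkℚ-±1 (+ _)    0 _ refl refl = inj₁ refl
mkℚ-±1 -[1+ 0 ] 0 _ refl refl = inj₂ refl

square-ratio≡±1 : ∀ {D} → IsRealQuadDisc D → ∀ a b c (r : ℚ) → r ≢ 0ℚ →
  ∣ b ℤ.* b ℤ.- + 4 ℤ.* a ℤ.* c ∣ ℕ.* 5 ℕ.< D ℕ.* 6 → r ℚ.* r ℚ.* fromℕ D ≡ fromℤ (b ℤ.* b ℤ.- + 4 ℤ.* a ℤ.* c) →
  r ≡ 1ℚ ⊎ r ≡ ℚ.- 1ℚ
square-ratio≡±1 {D} isDisc a b c r@(mkℚ u v u⊥v) r≢0 5Δ<6D r²D≡Δ = mkℚ-±1 u v u⊥v (proj₁ units) (proj₂ units)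
  where
  Δ : ℤ
  Δ = b ℤ.* b ℤ.- + 4 ℤ.* a ℤ.* c
  V² : ℕ
  V² = suc v ℕ.* suc v
  u²D≡Δv² : + (∣ u ∣ ℕ.* ∣ u ∣ ℕ.* D) ≡ Δ ℤ.* + V²
  u²D≡Δv² = mkℚ-square u v u⊥v D Δ r²D≡Δ
  Δ≡∣Δ∣ : Δ ≡ + ∣ Δ ∣
  Δ≡∣Δ∣ = nonNegative-factor Δ u²D≡Δv²
  units : ∣ u ∣ ≡ 1 × suc v ≡ 1
  units = coprime-square-ratio≡1 {D} {∣ u ∣} {suc v} {∣ Δ ∣} isDisc (Coprimality.recompute u⊥v)
    (λ u≡0 → r≢0 (ℚP.↥p≡0⇒p≡0 r (ℤP.∣i∣≡0⇒i≡0 u≡0)))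
    (ℤP.+-injective (trans u²D≡Δv² (trans (cong (ℤ._* + V²) Δ≡∣Δ∣) (sym (ℤP.pos-* ∣ Δ ∣ V²)))))
    5Δ<6D (discriminant-mod-4 a b c Δ≡∣Δ∣)

quadratic-root : ∀ A B C d p q → q ≢ 0ℚ →
  A ℚ.* (p ℚ.* p ℚ.+ q ℚ.* q ℚ.* d) ℚ.+ B ℚ.* p ℚ.+ C ≡ 0ℚ → q ℚ.* (fromℕ 2 ℚ.* A ℚ.* p ℚ.+ B) ≡ 0ℚ →
  fromℕ 2 ℚ.* A ℚ.* p ≡ ℚ.- B ×
  (fromℕ 2 ℚ.* A ℚ.* q) ℚ.* (fromℕ 2 ℚ.* A ℚ.* q) ℚ.* d ≡ B ℚ.* B ℚ.- fromℕ 4 ℚ.* A ℚ.* C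
quadratic-root A B C d p q q≢0 re≡0 im≡0 = 2Ap≡-B , [2Aq]²d≡B²-4AC
  where
  open +-*-Solver
  open ≡-Reasoning
  L : ℚ
  L = fromℕ 2 ℚ.* A ℚ.* p ℚ.+ B
  L≡0 : L ≡ 0ℚ
  L≡0 = x*y≡0⇒y≡0 q≢0 im≡0
  2Ap≡-B : fromℕ 2 ℚ.* A ℚ.* p ≡ ℚ.- B
  2Ap≡-B = begin
    fromℕ 2 ℚ.* A ℚ.* p  ≡⟨ solve 3 (λ A B p → con (fromℕ 2) :* A :* p := (con (fromℕ 2) :* A :* p :+ B) :- B) refl A B p ⟩
    L ℚ.- B              ≡⟨ cong (ℚ._- B) L≡0 ⟩
    0ℚ ℚ.- B             ≡⟨ ℚP.+-identityˡ (ℚ.- B) ⟩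
    ℚ.- B                ∎
  [2Aq]²d≡B²-4AC : (fromℕ 2 ℚ.* A ℚ.* q) ℚ.* (fromℕ 2 ℚ.* A ℚ.* q) ℚ.* d ≡ B ℚ.* B ℚ.- fromℕ 4 ℚ.* A ℚ.* C
  [2Aq]²d≡B²-4AC = begin
    (fromℕ 2 ℚ.* A ℚ.* q) ℚ.* (fromℕ 2 ℚ.* A ℚ.* q) ℚ.* d
      ≡⟨ solve 6 (λ A B C d p q → (con (fromℕ 2) :* A :* q) :* (con (fromℕ 2) :* A :* q) :* d :=
           (B :* B :- con (fromℕ 4) :* A :* C) :+ con (fromℕ 4) :* A :* (A :* (p :* p :+ q :* q :* d) :+ B :* p :+ C)
             :- (con (fromℕ 2) :* A :* p :+ B) :* (con (fromℕ 2) :* A :* p :+ B)) refl A B C d p q ⟩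
    (B ℚ.* B ℚ.- fromℕ 4 ℚ.* A ℚ.* C) ℚ.+ fromℕ 4 ℚ.* A ℚ.* (A ℚ.* (p ℚ.* p ℚ.+ q ℚ.* q ℚ.* d) ℚ.+ B ℚ.* p ℚ.+ C) ℚ.- L ℚ.* L
      ≡⟨ cong₂ (λ u v → (B ℚ.* B ℚ.- fromℕ 4 ℚ.* A ℚ.* C) ℚ.+ fromℕ 4 ℚ.* A ℚ.* u ℚ.- v ℚ.* v) re≡0 L≡0 ⟩
    (B ℚ.* B ℚ.- fromℕ 4 ℚ.* A ℚ.* C) ℚ.+ fromℕ 4 ℚ.* A ℚ.* 0ℚ ℚ.- 0ℚ ℚ.* 0ℚ
      ≡⟨ solve 3 (λ A B C → (B :* B :- con (fromℕ 4) :* A :* C) :+ con (fromℕ 4) :* A :* con 0ℚ :- con 0ℚ :* con 0ℚ :=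
           B :* B :- con (fromℕ 4) :* A :* C) refl A B C ⟩
    B ℚ.* B ℚ.- fromℕ 4 ℚ.* A ℚ.* C
      ∎

module Roots (D : ℕ) where
  open Field D
  open +-*-Solver

  /1≡fromℤ-cong : ∀ (f : ℚ → ℚ → ℚ → ℚ → ℚ) a b c →
                  f (a / 1) (b / 1) (c / 1) Dℚ ≡ f (fromℤ a) (fromℤ b) (fromℤ c) (fromℕ D)
  /1≡fromℤ-cong f a b c rewrite /1≡fromℤ a | /1≡fromℤ b | /1≡fromℤ c | /1≡fromℤ (+ D) = refl

  evalPoly-re : ∀ a b c p q → re (evalPoly a b c (p +√D· q)) ≡
                fromℤ a ℚ.* (p ℚ.* p ℚ.+ q ℚ.* q ℚ.* fromℕ D) ℚ.+ fromℤ b ℚ.* p ℚ.+ fromℤ c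
  evalPoly-re a b c p q = trans
    (solve 6 (λ A B C d p q →
      (A :* (p :* p :+ q :* q :* d) :+ con 0ℚ :* (p :* q :+ q :* p) :* d) :+ ((B :* p :+ con 0ℚ :* q :* d) :+ C) :=
      A :* (p :* p :+ q :* q :* d) :+ B :* p :+ C) refl (a / 1) (b / 1) (c / 1) Dℚ p q)
    (/1≡fromℤ-cong (λ A B C d → A ℚ.* (p ℚ.* p ℚ.+ q ℚ.* q ℚ.* d) ℚ.+ B ℚ.* p ℚ.+ C) a b c)

  evalPoly-im : ∀ a b c p q → im (evalPoly a b c (p +√D· q)) ≡ q ℚ.* (fromℕ 2 ℚ.* fromℤ a ℚ.* p ℚ.+ fromℤ b)
  evalPoly-im a b c p q = trans
    (solve 5 (λ A B d p q →
      (A :* (p :* q :+ q :* p) :+ con 0ℚ :* (p :* p :+ q :* q :* d)) :+ ((B :* q :+ con 0ℚ :* p) :+ con 0ℚ) :=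
      q :* (con (fromℕ 2) :* A :* p :+ B)) refl (a / 1) (b / 1) Dℚ p q)
    (/1≡fromℤ-cong (λ A B _ _ → q ℚ.* (fromℕ 2 ℚ.* A ℚ.* p ℚ.+ B)) a b c)

  irrational-root : ∀ a b c {p q} → (∀ r → ¬ (evalPoly a b c (embed r) ≡ embed 0ℚ)) →
                    evalPoly a b c (p +√D· q) ≡ embed 0ℚ → q ≢ 0ℚ
  irrational-root a b c {p} irreducible root q≡0 =
    irreducible p (subst (λ y → evalPoly a b c (p +√D· y) ≡ embed 0ℚ) q≡0 root)

  root-equations : ∀ a b c {p q} → q ≢ 0ℚ → evalPoly a b c (p +√D· q) ≡ embed 0ℚ →
    fromℤ (+ 2 ℤ.* a) ℚ.* p ≡ ℚ.- fromℤ b ×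
    fromℤ (+ 2 ℤ.* a) ℚ.* q ℚ.* (fromℤ (+ 2 ℤ.* a) ℚ.* q) ℚ.* fromℕ D ≡ fromℤ (b ℤ.* b ℤ.- + 4 ℤ.* a ℤ.* c)
  root-equations a b c {p} {q} q≢0 root =
    subst (λ t → t ℚ.* p ≡ ℚ.- fromℤ b × t ℚ.* q ℚ.* (t ℚ.* q) ℚ.* fromℕ D ≡ fromℤ (b ℤ.* b ℤ.- + 4 ℤ.* a ℤ.* c))
      (sym (fromℤ-homo-* (+ 2) a))
      (Product.map₂ (λ e → trans e (sym (fromℤ-discriminant a b c)))
        (quadratic-root (fromℤ a) (fromℤ b) (fromℤ c) (fromℕ D) p q q≢0
          (trans (sym (evalPoly-re a b c p q)) (cong re root)) (trans (sym (evalPoly-im a b c p q)) (cong im root))))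

module Positivity (D : ℕ) where
  open Field D

  module _ (t : ℚ) .{{_ : Positive t}} where
    open Scaling t
    open Scaling (t ℚ.* t) {{ℚP.pos*pos⇒pos t t}} using () renaming (scaled-< to scaled²-<)

    private
      t*0≡0 : t ℚ.* 0ℚ ≡ 0ℚ
      t*0≡0 = ℚP.*-zeroʳ t

    Pos-scaled : ∀ {x y x′ y′} → t ℚ.* x ≡ x′ → t ℚ.* y ≡ y′ → Pos (x′ +√D· y′) → Pos (x +√D· y)
    Pos-scaled tx ty (inj₁ (x′≥0 , y′≥0 , x′>0⊎y′>0)) =
      inj₁ (scaled-≤ t*0≡0 tx x′≥0 , scaled-≤ t*0≡0 ty y′≥0 , Sum.map (scaled-< t*0≡0 tx) (scaled-< t*0≡0 ty) x′>0⊎y′>0)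
    Pos-scaled tx ty (inj₂ (inj₁ (x′>0 , y′<0 , y′²D<x′²))) =
      inj₂ (inj₁ (scaled-< t*0≡0 tx x′>0 , scaled-< ty t*0≡0 y′<0 , scaled²-< (scaled-square-* ty Dℚ) (scaled-square tx) y′²D<x′²))
    Pos-scaled tx ty (inj₂ (inj₂ (x′<0 , y′>0 , x′²<y′²D))) =
      inj₂ (inj₂ (scaled-< tx t*0≡0 x′<0 , scaled-< t*0≡0 ty y′>0 , scaled²-< (scaled-square tx) (scaled-square-* ty Dℚ) x′²<y′²D))

  Pos-n+√D : ∀ n → Pos (fromℕ n +√D· 1ℚ)
  Pos-n+√D n = inj₁ (ℚP.nonNegative⁻¹ (fromℕ n) , ℚP.nonNegative⁻¹ 1ℚ , inj₂ (ℚP.positive⁻¹ 1ℚ))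

  Pos-√D-n : ∀ n → n ℕ.* n ℕ.< D → Pos ((ℚ.- fromℕ n) +√D· 1ℚ)
  Pos-√D-n zero    _    = Pos-n+√D 0
  Pos-√D-n (suc n) n²<D =
    inj₂ (inj₂ (ℚP.negative⁻¹ _ , ℚP.positive⁻¹ 1ℚ , subst₂ ℚ._<_ n² D′ (fromℤ-mono-< (ℤ.+<+ n²<D))))
    where
    n² : fromℕ (suc n ℕ.* suc n) ≡ ℚ.- fromℕ (suc n) ℚ.* ℚ.- fromℕ (suc n)
    n² = fromℤ-homo-* -[1+ n ] -[1+ n ]
    D′ : fromℕ D ≡ 1ℚ ℚ.* 1ℚ ℚ.* Dℚ
    D′ = sym (trans (ℚP.*-identityˡ Dℚ) (/1≡fromℤ (+ D)))

  Pos-n-√D : ∀ n → D ℕ.< n ℕ.* n → Pos (fromℕ n +√D· (ℚ.- 1ℚ))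
  Pos-n-√D (suc n) D<n² =
    inj₂ (inj₁ (ℚP.positive⁻¹ _ , ℚP.negative⁻¹ _ , subst₂ ℚ._<_ D′ (fromℕ-square (suc n)) (fromℤ-mono-< (ℤ.+<+ D<n²))))
    where
    D′ : fromℕ D ≡ ℚ.- 1ℚ ℚ.* ℚ.- 1ℚ ℚ.* Dℚ
    D′ = sym (trans (ℚP.*-identityˡ Dℚ) (/1≡fromℤ (+ D)))

-- Consequences of the height bound

module Height (D : ℕ) where
  open Field D
  open +-*-Solver

  height-bound : ∀ h → 0 ℕ.< h → embedℤ (+ h) ≤ᴷ (0ℚ +√D· (+ 12 / 25)) → h ℕ.* h ℕ.* 625 ℕ.< D ℕ.* 144
  height-bound (suc h) _ (inj₁ ())
  height-bound (suc h) _ (inj₂ (inj₁ (0≤-h , _)))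
    with fromℤ-cancel-≤ (subst (0ℚ ℚ.≤_) (trans (ℚP.+-identityˡ _) (cong ℚ.-_ (/1≡fromℤ (+ suc h)))) 0≤-h)
  ... | ()
  height-bound (suc h) _ (inj₂ (inj₂ (inj₁ (_ , ℚ.*<* (ℤ.+<+ ()) , _))))
  height-bound h _ (inj₂ (inj₂ (inj₂ (_ , _ , h²<[12/25]²D)))) =
    ℤP.drop‿+<+ (fromℤ-cancel-< (subst₂ ℚ._<_ 625h² 144D (ℚP.*-monoʳ-<-pos (fromℕ 625) h²<[12/25]²D)))
    where
    open ≡-Reasoning
    x y : ℚ
    x = 0ℚ ℚ.- + h / 1
    y = + 12 / 25 ℚ.- 0ℚ
    x≡-h : x ≡ ℚ.- fromℕ h
    x≡-h = trans (ℚP.+-identityˡ _) (cong ℚ.-_ (/1≡fromℤ (+ h)))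
    625h² : fromℕ 625 ℚ.* (x ℚ.* x) ≡ fromℕ (h ℕ.* h ℕ.* 625)
    625h² = begin
      fromℕ 625 ℚ.* (x ℚ.* x)                      ≡⟨ cong (λ z → fromℕ 625 ℚ.* (z ℚ.* z)) x≡-h ⟩
      fromℕ 625 ℚ.* (ℚ.- fromℕ h ℚ.* ℚ.- fromℕ h)  ≡⟨ solve 2 (λ s z → s :* ((:- z) :* (:- z)) := (z :* z) :* s) refl (fromℕ 625) (fromℕ h) ⟩
      fromℕ h ℚ.* fromℕ h ℚ.* fromℕ 625            ≡⟨ cong (ℚ._* fromℕ 625) (fromℕ-square h) ⟨
      fromℕ (h ℕ.* h) ℚ.* fromℕ 625                ≡⟨ fromℤ-homo-* (+ (h ℕ.* h)) (+ 625) ⟨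
      fromℤ (+ (h ℕ.* h) ℤ.* + 625)                ≡⟨ cong fromℤ (ℤP.pos-* (h ℕ.* h) 625) ⟨
      fromℕ (h ℕ.* h ℕ.* 625)                      ∎
    144D : fromℕ 625 ℚ.* (y ℚ.* y ℚ.* Dℚ) ≡ fromℕ (D ℕ.* 144)
    144D = begin
      fromℕ 625 ℚ.* (y ℚ.* y ℚ.* Dℚ)  ≡⟨ solve 3 (λ s y d → s :* (y :* y :* d) := d :* (s :* y :* y)) refl (fromℕ 625) y Dℚ ⟩
      Dℚ ℚ.* (fromℕ 625 ℚ.* y ℚ.* y)  ≡⟨ cong (ℚ._* fromℕ 144) (/1≡fromℤ (+ D)) ⟩
      fromℕ D ℚ.* fromℕ 144           ≡⟨ fromℤ-homo-* (+ D) (+ 144) ⟨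
      fromℤ (+ D ℤ.* + 144)           ≡⟨ cong fromℤ (ℤP.pos-* D 144) ⟨
      fromℕ (D ℕ.* 144)               ∎

height-components : ∀ {a b c h : ℕ} → h ≡ (a ℕ.⊔ b) ℕ.⊔ c → a ℕ.≤ h × b ℕ.≤ h × c ℕ.≤ h
height-components {a} {b} {c} refl =
  ℕP.≤-trans (ℕP.m≤m⊔n a b) (ℕP.m≤m⊔n (a ℕ.⊔ b) c) ,
  ℕP.≤-trans (ℕP.m≤n⊔m a b) (ℕP.m≤m⊔n (a ℕ.⊔ b) c) ,
  ℕP.m≤n⊔m (a ℕ.⊔ b) c

module HeightBounds {D h : ℕ} (625h²<144D : h ℕ.* h ℕ.* 625 ℕ.< D ℕ.* 144) where
  open ℕP.≤-Reasoning

  square<D : ∀ {n} → n ℕ.≤ 2 ℕ.* h → n ℕ.* n ℕ.< D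
  square<D {n} n≤2h = ℕP.*-cancelʳ-< 144 (n ℕ.* n) D (begin-strict
    n ℕ.* n ℕ.* 144                ≤⟨ ℕP.*-monoˡ-≤ 144 (ℕP.*-mono-≤ n≤2h n≤2h) ⟩
    2 ℕ.* h ℕ.* (2 ℕ.* h) ℕ.* 144  ≡⟨ ℕ-Ring.solve (h ∷ []) ⟩
    h ℕ.* h ℕ.* 576                ≤⟨ ℕP.*-monoʳ-≤ (h ℕ.* h) (ℕP.m≤m+n 576 49) ⟩
    h ℕ.* h ℕ.* 625                <⟨ 625h²<144D ⟩
    D ℕ.* 144                      ∎)

  -- |Δ| ≤ 5h² < (720/625) D; the weaker |Δ| < (6/5) D suffices and keeps the numerals small.
  discriminant-bound : ∀ a b c → ∣ a ∣ ℕ.≤ h → ∣ b ∣ ℕ.≤ h → ∣ c ∣ ℕ.≤ h →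
                       ∣ b ℤ.* b ℤ.- + 4 ℤ.* a ℤ.* c ∣ ℕ.* 5 ℕ.< D ℕ.* 6
  discriminant-bound a b c a≤h b≤h c≤h = ℕP.*-cancelʳ-< 25 _ _ (begin-strict
    ∣ b ℤ.* b ℤ.- + 4 ℤ.* a ℤ.* c ∣ ℕ.* 5 ℕ.* 25  ≤⟨ ℕP.*-monoˡ-≤ 25 (ℕP.*-monoˡ-≤ 5 ∣Δ∣≤5h²) ⟩
    h ℕ.* h ℕ.* 5 ℕ.* 5 ℕ.* 25                   ≡⟨ ℕ-Ring.solve (h ∷ []) ⟩
    h ℕ.* h ℕ.* 625                              <⟨ 625h²<144D ⟩
    D ℕ.* 144                                    ≤⟨ ℕP.*-monoʳ-≤ D (ℕP.m≤m+n 144 6) ⟩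
    D ℕ.* 150                                    ≡⟨ ℕ-Ring.solve (D ∷ []) ⟩
    D ℕ.* 6 ℕ.* 25                               ∎)
    where
    ∣Δ∣≤5h² : ∣ b ℤ.* b ℤ.- + 4 ℤ.* a ℤ.* c ∣ ℕ.≤ h ℕ.* h ℕ.* 5
    ∣Δ∣≤5h² = ∣discriminant∣-bound a b c a≤h b≤h c≤h

  reduced-bounds : ∀ A B C .{{_ : NonZero A}} → A ℕ.≤ h → B ℕ.≤ h → C ℕ.≤ h → D ≡ B ℕ.* B ℕ.+ 4 ℕ.* A ℕ.* C →
    (2 ℕ.* A ℕ.∸ B) ℕ.* (2 ℕ.* A ℕ.∸ B) ℕ.< D × B ℕ.* B ℕ.< D × D ℕ.< (B ℕ.+ 2 ℕ.* A) ℕ.* (B ℕ.+ 2 ℕ.* A)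
  reduced-bounds A B C A≤h B≤h C≤h D≡ =
    square<D (ℕP.≤-trans (ℕP.m∸n≤m (2 ℕ.* A) B) (ℕP.*-monoʳ-≤ 2 A≤h)) ,
    square<D (ℕP.≤-trans B≤h (ℕP.m≤n*m h 2)) ,
    (begin-strict
      D                                    ≡⟨ D≡ ⟩
      B ℕ.* B ℕ.+ 4 ℕ.* A ℕ.* C            <⟨ ℕP.+-monoʳ-< (B ℕ.* B) (ℕP.*-monoʳ-< (4 ℕ.* A) {{ℕP.m*n≢0 4 A}} C<A+B) ⟩
      B ℕ.* B ℕ.+ 4 ℕ.* A ℕ.* (A ℕ.+ B)    ≡⟨ ℕ-Ring.solve (A ∷ B ∷ []) ⟩
      (B ℕ.+ 2 ℕ.* A) ℕ.* (B ℕ.+ 2 ℕ.* A)  ∎)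
    where
    C<A+B : C ℕ.< A ℕ.+ B
    C<A+B = ℕP.≰⇒> λ A+B≤C → ℕP.<-irrefl refl (begin-strict
      (A ℕ.* C ℕ.+ B ℕ.* B) ℕ.* 625        ≤⟨ ℕP.*-monoˡ-≤ 625 (begin
        A ℕ.* C ℕ.+ B ℕ.* B                  ≤⟨ ℕP.+-monoʳ-≤ (A ℕ.* C) (ℕP.*-monoʳ-≤ B (ℕP.≤-trans (ℕP.m≤n+m B A) A+B≤C)) ⟩
        A ℕ.* C ℕ.+ B ℕ.* C                  ≡⟨ ℕP.*-distribʳ-+ C A B ⟨
        (A ℕ.+ B) ℕ.* C                      ≤⟨ ℕP.*-monoˡ-≤ C A+B≤C ⟩
        C ℕ.* C                              ∎) ⟩
      C ℕ.* C ℕ.* 625                      ≤⟨ ℕP.*-monoˡ-≤ 625 (ℕP.*-mono-≤ C≤h C≤h) ⟩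
      h ℕ.* h ℕ.* 625                      <⟨ 625h²<144D ⟩
      D ℕ.* 144                            ≡⟨ cong (ℕ._* 144) D≡ ⟩
      (B ℕ.* B ℕ.+ 4 ℕ.* A ℕ.* C) ℕ.* 144  ≡⟨ ℕ-Ring.solve (A ∷ B ∷ C ∷ []) ⟩
      A ℕ.* C ℕ.* 576 ℕ.+ B ℕ.* B ℕ.* 144  ≤⟨ ℕP.+-mono-≤ (ℕP.*-monoʳ-≤ (A ℕ.* C) (ℕP.m≤m+n 576 49)) (ℕP.*-monoʳ-≤ (B ℕ.* B) (ℕP.m≤m+n 144 481)) ⟩
      A ℕ.* C ℕ.* 625 ℕ.+ B ℕ.* B ℕ.* 625  ≡⟨ ℕP.*-distribʳ-+ 625 (A ℕ.* C) (B ℕ.* B) ⟨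
      (A ℕ.* C ℕ.+ B ℕ.* B) ℕ.* 625        ∎)

module Reducedness (D : ℕ) where
  open Field D
  open Positivity D
  open +-*-Solver

  -- x + y√D = (B + √D)/(2A); after scaling by 2A the three order conditions become
  -- 2A - B < √D, √D < B + 2A and B < √D.
  reduced-if : ∀ A B C {x y} .{{_ : NonZero A}} → D ≡ B ℕ.* B ℕ.+ 4 ℕ.* A ℕ.* C →
    (2 ℕ.* A ℕ.∸ B) ℕ.* (2 ℕ.* A ℕ.∸ B) ℕ.< D × B ℕ.* B ℕ.< D × D ℕ.< (B ℕ.+ 2 ℕ.* A) ℕ.* (B ℕ.+ 2 ℕ.* A) →
    fromℕ (2 ℕ.* A) ℚ.* x ≡ fromℕ B → fromℕ (2 ℕ.* A) ℚ.* y ≡ 1ℚ → Reduced (x +√D· y)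
  reduced-if A@(suc _) B C {x} {y} D≡ ([2A-B]²<D , B²<D , D<[B+2A]²) tx≡B ty≡1 =
    (+ A , + B , ℤ.- + C , (λ ()) , trans (pos-discriminant A B C) (sym (cong +_ D≡)) , defining-equation) ,
    1<β , -1<β′ , β′<0
    where
    open ≡-Reasoning
    t : ℚ
    t = fromℕ (2 ℕ.* A)

    defining-equation : embedℤ (+ 2 ℤ.* + A) ⊗ (x +√D· y) ≡ embedℤ (+ B) ⊕ √D
    defining-equation = cong₂ _+√D·_
      (begin
        (+ 2 ℤ.* + A) / 1 ℚ.* x ℚ.+ 0ℚ ℚ.* y ℚ.* Dℚ  ≡⟨ cong₂ ℚ._+_ (cong (ℚ._* x) (/1≡fromℤ (+ 2 ℤ.* + A)))
                                                               (trans (cong (ℚ._* Dℚ) (ℚP.*-zeroˡ y)) (ℚP.*-zeroˡ Dℚ)) ⟩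
        t ℚ.* x ℚ.+ 0ℚ                              ≡⟨ ℚP.+-identityʳ (t ℚ.* x) ⟩
        t ℚ.* x                                     ≡⟨ tx≡B ⟩
        fromℕ B                                     ≡⟨ /1≡fromℤ (+ B) ⟨
        + B / 1                                     ≡⟨ ℚP.+-identityʳ (+ B / 1) ⟨
        + B / 1 ℚ.+ 0ℚ                              ∎)
      (begin
        (+ 2 ℤ.* + A) / 1 ℚ.* y ℚ.+ 0ℚ ℚ.* x        ≡⟨ cong₂ ℚ._+_ (cong (ℚ._* y) (/1≡fromℤ (+ 2 ℤ.* + A))) (ℚP.*-zeroˡ x) ⟩
        t ℚ.* y ℚ.+ 0ℚ                              ≡⟨ ℚP.+-identityʳ (t ℚ.* y) ⟩
        t ℚ.* y                                     ≡⟨ ty≡1 ⟩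
        1ℚ                                          ≡⟨ ℚP.+-identityˡ 1ℚ ⟨
        0ℚ ℚ.+ 1ℚ                                   ∎)

    t[x-1] : t ℚ.* (x ℚ.- 1ℚ) ≡ fromℤ (B ℤ.⊖ 2 ℕ.* A)
    t[x-1] = trans (solve 2 (λ t x → t :* (x :- con 1ℚ) := t :* x :- t) refl t x)
                   (trans (cong (ℚ._- t) tx≡B) (fromℕ-sub B (2 ℕ.* A)))

    t[y-0] : t ℚ.* (y ℚ.- 0ℚ) ≡ 1ℚ
    t[y-0] = trans (solve 2 (λ t y → t :* (y :- con 0ℚ) := t :* y) refl t y) ty≡1

    1<β : embed 1ℚ <ᴷ (x +√D· y)
    1<β with ℕP.≤-<-connex (2 ℕ.* A) B
    ... | inj₁ 2A≤B = Pos-scaled t (trans t[x-1] (cong fromℤ (ℤP.⊖-≥ 2A≤B))) t[y-0] (Pos-n+√D (B ℕ.∸ 2 ℕ.* A))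
    ... | inj₂ B<2A = Pos-scaled t (trans t[x-1] (trans (cong fromℤ (ℤP.⊖-< B<2A)) (fromℤ-homo-neg _))) t[y-0]
                        (Pos-√D-n (2 ℕ.* A ℕ.∸ B) [2A-B]²<D)

    -1<β′ : embed (ℚ.- 1ℚ) <ᴷ conj (x +√D· y)
    -1<β′ = Pos-scaled t t[x+1] t[-y-0] (Pos-n-√D (B ℕ.+ 2 ℕ.* A) D<[B+2A]²)
      where
      t[x+1] : t ℚ.* (x ℚ.- ℚ.- 1ℚ) ≡ fromℕ (B ℕ.+ 2 ℕ.* A)
      t[x+1] = trans (solve 2 (λ t x → t :* (x :- (:- con 1ℚ)) := t :* x :+ t) refl t x)
                     (trans (cong (ℚ._+ t) tx≡B) (sym (fromℕ-homo-+ B (2 ℕ.* A))))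
      t[-y-0] : t ℚ.* (ℚ.- y ℚ.- 0ℚ) ≡ ℚ.- 1ℚ
      t[-y-0] = trans (solve 2 (λ t y → t :* (:- y :- con 0ℚ) := :- (t :* y)) refl t y) (cong ℚ.-_ ty≡1)

    β′<0 : conj (x +√D· y) <ᴷ embed 0ℚ
    β′<0 = Pos-scaled t t[0-x] t[0+y] (Pos-√D-n B B²<D)
      where
      t[0-x] : t ℚ.* (0ℚ ℚ.- x) ≡ ℚ.- fromℕ B
      t[0-x] = trans (solve 2 (λ t x → t :* (con 0ℚ :- x) := :- (t :* x)) refl t x) (cong ℚ.-_ tx≡B)
      t[0+y] : t ℚ.* (0ℚ ℚ.- ℚ.- y) ≡ 1ℚ
      t[0+y] = trans (solve 2 (λ t y → t :* (con 0ℚ :- (:- y)) := t :* y) refl t y) ty≡1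

module SignedConjugates (D : ℕ) where
  open Field D

  SignedConjugateReduced : K → Set
  SignedConjugateReduced α = Reduced α ⊎ Reduced (conj α) ⊎ Reduced (⊖ α) ⊎ Reduced (⊖ conj α)

  conj-involutive : ∀ α → conj (conj α) ≡ α
  conj-involutive (p +√D· q) = cong (p +√D·_) (neg-involutive q)

  signedConjugateReduced-conj : ∀ {α} → SignedConjugateReduced (conj α) → SignedConjugateReduced α
  signedConjugateReduced-conj     (inj₁ r)               = inj₂ (inj₁ r)
  signedConjugateReduced-conj {α} (inj₂ (inj₁ r))        = inj₁ (subst Reduced (conj-involutive α) r)
  signedConjugateReduced-conj     (inj₂ (inj₂ (inj₁ r))) = inj₂ (inj₂ (inj₂ r))
  signedConjugateReduced-conj {α} (inj₂ (inj₂ (inj₂ r))) =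
    inj₂ (inj₂ (inj₁ (subst (λ β → Reduced (⊖ β)) (conj-involutive α) r)))

module RootNormalisation (D : ℕ) (isDisc : IsRealQuadDisc D) {h : ℕ} (625h²<144D : h ℕ.* h ℕ.* 625 ℕ.< D ℕ.* 144) where
  open Field D
  open Reducedness D
  open SignedConjugates D
  open HeightBounds {D} {h} 625h²<144D

  reduced-root : ∀ A B c {x y} .{{_ : NonZero A}} → + B ℤ.* + B ℤ.- + 4 ℤ.* + A ℤ.* c ≡ + D →
    A ℕ.≤ h → B ℕ.≤ h → ∣ c ∣ ℕ.≤ h →
    fromℕ (2 ℕ.* A) ℚ.* x ≡ fromℕ B → fromℕ (2 ℕ.* A) ℚ.* y ≡ 1ℚ → Reduced (x +√D· y)
  reduced-root A B c Δ≡D A≤h B≤h c≤h = reduced-if A B ∣ c ∣ D≡ (reduced-bounds A B ∣ c ∣ A≤h B≤h c≤h D≡)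
    where
    D≡ : D ≡ B ℕ.* B ℕ.+ 4 ℕ.* A ℕ.* ∣ c ∣
    D≡ = discriminant≡B²+4A∣c∣ A B c Δ≡D (square<D (ℕP.≤-trans B≤h (ℕP.m≤n*m h 2)))

  signedConjugateReduced-normalised-root : ∀ A b c {p q} .{{_ : NonZero A}} → b ℤ.* b ℤ.- + 4 ℤ.* + A ℤ.* c ≡ + D →
    A ℕ.≤ h → ∣ b ∣ ℕ.≤ h → ∣ c ∣ ℕ.≤ h →
    fromℕ (2 ℕ.* A) ℚ.* p ≡ ℚ.- fromℤ b → fromℕ (2 ℕ.* A) ℚ.* q ≡ 1ℚ → SignedConjugateReduced (p +√D· q)
  signedConjugateReduced-normalised-root A (+ B) c {p} {q} Δ≡D A≤h B≤h c≤h tp≡-B tq≡1 =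
    inj₂ (inj₂ (inj₂ (reduced-root A B c Δ≡D A≤h B≤h c≤h (scaled-neg t p (fromℕ B) tp≡-B)
                                                         (trans (cong (t ℚ.*_) (neg-involutive q)) tq≡1))))
    where t = fromℕ (2 ℕ.* A)
  signedConjugateReduced-normalised-root A -[1+ n ] c Δ≡D A≤h b≤h c≤h tp≡-b tq≡1 =
    inj₁ (reduced-root A (suc n) c Δ≡D A≤h b≤h c≤h tp≡-b tq≡1)

  signedConjugateReduced-positive-root : ∀ A b c {p q} .{{_ : NonZero A}} → b ℤ.* b ℤ.- + 4 ℤ.* + A ℤ.* c ≡ + D →
    A ℕ.≤ h → ∣ b ∣ ℕ.≤ h → ∣ c ∣ ℕ.≤ h →
    fromℕ (2 ℕ.* A) ℚ.* p ≡ ℚ.- fromℤ b → fromℕ (2 ℕ.* A) ℚ.* q ≡ 1ℚ ⊎ fromℕ (2 ℕ.* A) ℚ.* q ≡ ℚ.- 1ℚ →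
    SignedConjugateReduced (p +√D· q)
  signedConjugateReduced-positive-root A b c Δ≡D A≤h b≤h c≤h tp≡-b (inj₁ tq≡1) =
    signedConjugateReduced-normalised-root A b c Δ≡D A≤h b≤h c≤h tp≡-b tq≡1
  signedConjugateReduced-positive-root A b c {p} {q} Δ≡D A≤h b≤h c≤h tp≡-b (inj₂ tq≡-1) =
    signedConjugateReduced-conj
      (signedConjugateReduced-normalised-root A b c Δ≡D A≤h b≤h c≤h tp≡-b (scaled-neg (fromℕ (2 ℕ.* A)) q 1ℚ tq≡-1))

  signedConjugateReduced-root : ∀ a b c {p q} → a ≢ + 0 → b ℤ.* b ℤ.- + 4 ℤ.* a ℤ.* c ≡ + D →
    ∣ a ∣ ℕ.≤ h → ∣ b ∣ ℕ.≤ h → ∣ c ∣ ℕ.≤ h →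
    fromℤ (+ 2 ℤ.* a) ℚ.* p ≡ ℚ.- fromℤ b → fromℤ (+ 2 ℤ.* a) ℚ.* q ≡ 1ℚ ⊎ fromℤ (+ 2 ℤ.* a) ℚ.* q ≡ ℚ.- 1ℚ →
    SignedConjugateReduced (p +√D· q)
  signedConjugateReduced-root (+ zero) b c a≢0 = ⊥-elim (a≢0 refl)
  signedConjugateReduced-root +[1+ k ] b c a≢0 = signedConjugateReduced-positive-root (suc k) b c
  signedConjugateReduced-root -[1+ k ] b c {p} {q} a≢0 Δ≡D a≤h b≤h c≤h tp≡-b tq≡±1 =
    signedConjugateReduced-positive-root (suc k) (ℤ.- b) (ℤ.- c) (trans (negate-all -[1+ k ] b c) Δ≡D)
      a≤h (subst (ℕ._≤ h) (sym (ℤP.∣-i∣≡∣i∣ b)) b≤h) (subst (ℕ._≤ h) (sym (ℤP.∣-i∣≡∣i∣ c)) c≤h)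
      (neg-scaled t p _ (trans tp≡-b (cong ℚ.-_ (trans (cong fromℤ (sym (ℤP.neg-involutive b))) (fromℤ-homo-neg (ℤ.- b))))))
      (Sum.swap (Sum.map (neg-scaled t q (ℚ.- 1ℚ)) (neg-scaled t q 1ℚ) tq≡±1))
    where
    t : ℚ
    t = fromℕ (2 ℕ.* suc k)
    negate-all : ∀ a b c → ℤ.- b ℤ.* ℤ.- b ℤ.- + 4 ℤ.* ℤ.- a ℤ.* ℤ.- c ≡ b ℤ.* b ℤ.- + 4 ℤ.* a ℤ.* c
    negate-all = solve-∀

  signedConjugateReduced-of-root : ∀ a b c {p q} → a ≢ + 0 → ∣ a ∣ ℕ.≤ h × ∣ b ∣ ℕ.≤ h × ∣ c ∣ ℕ.≤ h → q ≢ 0ℚ →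
    fromℤ (+ 2 ℤ.* a) ℚ.* p ≡ ℚ.- fromℤ b ×
    fromℤ (+ 2 ℤ.* a) ℚ.* q ℚ.* (fromℤ (+ 2 ℤ.* a) ℚ.* q) ℚ.* fromℕ D ≡ fromℤ (b ℤ.* b ℤ.- + 4 ℤ.* a ℤ.* c) →
    SignedConjugateReduced (p +√D· q)
  signedConjugateReduced-of-root a b c {p} {q} a≢0 (a≤h , b≤h , c≤h) q≢0 (2ap≡-b , [2aq]²D≡Δ) =
    signedConjugateReduced-root a b c a≢0 Δ≡D a≤h b≤h c≤h 2ap≡-b 2aq≡±1
    where
    2aq≡±1 : fromℤ (+ 2 ℤ.* a) ℚ.* q ≡ 1ℚ ⊎ fromℤ (+ 2 ℤ.* a) ℚ.* q ≡ ℚ.- 1ℚ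
    2aq≡±1 = square-ratio≡±1 isDisc a b c (fromℤ (+ 2 ℤ.* a) ℚ.* q) (q≢0 ∘ x*y≡0⇒y≡0 (fromℤ-2*-≢0 a≢0))
               (discriminant-bound a b c a≤h b≤h c≤h) [2aq]²D≡Δ
    Δ≡D : b ℤ.* b ℤ.- + 4 ℤ.* a ℤ.* c ≡ + D
    Δ≡D = cong ℚ.↥_ (trans (sym [2aq]²D≡Δ) (±1-square (fromℕ D) 2aq≡±1))

lemma3 : (D : ℕ) → IsRealQuadDisc D →
    let open Field D in
    (α : K) → Generates α →
    (h : ℕ) → Height α h →
    embedℤ (+ h) ≤ᴷ (0ℚ +√D· (+ 12 / 25)) →
    Reduced α ⊎ Reduced (conj α) ⊎ Reduced (⊖ α) ⊎ Reduced (⊖ conj α)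
lemma3 D isDisc (p +√D· q) _ h (a , b , c , (a≢0 , _ , irreducible , root) , h≡) h≤[12/25]√D =
  signedConjugateReduced-of-root a b c a≢0 bounds q≢0 (root-equations a b c q≢0 root)
  where
  open Roots D
  q≢0 : q ≢ 0ℚ
  q≢0 = irrational-root a b c irreducible root
  bounds : ∣ a ∣ ℕ.≤ h × ∣ b ∣ ℕ.≤ h × ∣ c ∣ ℕ.≤ h
  bounds = height-components h≡
  0<h : 0 ℕ.< h
  0<h = ℕP.<-≤-trans (ℕP.n≢0⇒n>0 (a≢0 ∘ ℤP.∣i∣≡0⇒i≡0)) (proj₁ bounds)
  open RootNormalisation D isDisc {h} (Height.height-bound D h 0<h h≤[12/25]√D)
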